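{- For every $\mathcal{S}\subseteq 2^{[n]}$, $\mathrm{VCdim}(\mathcal{S})\le\mathrm{HHdim}(\mathcal{S})$.
   Context: $\mathrm{VCdim}(\mathcal{S})$ is the maximum cardinality of a set $A\subseteq[n]$ shattered by $\mathcal{S}$, i.e., such that every subset of $A$ equals $A\cap S$ for some $S\in\mathcal{S}$. Subsets are identified with $0/1$ vectors; $u\circ v$ is the coordinatewise product and $\operatorname{supp}(v)=\{i:v_i\ne0\}$. $H(\mathcal{S},v)=\{i\in[n]:\exists s\in\mathcal{S}\text{ with }\operatorname{supp}(s\circ v)=\{i\}\}$ and $\mathrm{HHdim}(\mathcal{S})=\sup_{v\in\mathbb{R}^n}|H(\mathcal{S},v)|$. -}

module Defs where

open import Data.Nat using (ℕ)
open import Data.Bool using (if_then_else_)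
open import Data.Fin using (Fin)
open import Data.Fin.Subset using (Subset; inside; outside; _⊆_; _∩_; ⁅_⁆; ∣_∣)
open import Data.Vec using (Vec; tabulate; lookup)
open import Data.Vec.Properties using (≡-dec)
open import Data.Bool.Properties renaming (_≟_ to _≟ᵇ_)
open import Data.List using (List)
open import Data.List.Membership.Propositional using (_∈_)
open import Data.List.Relation.Unary.Any using (any?)
open import Data.Product using (∃; _×_)
open import Data.Rational using (ℚ; 0ℚ; 1ℚ; _*_)
open import Data.Rational.Properties using (_≟_)
open import Relation.Binary.PropositionalEquality using (_≡_)
open import Relation.Nullary.Decidable using (does)

Family : ℕ → Set
Family n = List (Subset n)

Shatters : ∀ {n} → Family n → Subset n → Set
Shatters 𝒮 A = ∀ B → B ⊆ A → ∃ λ S → S ∈ 𝒮 × (A ∩ S ≡ B)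

toVec : ∀ {n} → Subset n → Vec ℚ n
toVec s = tabulate λ i → if lookup s i then 1ℚ else 0ℚ

_∘ᵥ_ : ∀ {n} → Vec ℚ n → Vec ℚ n → Vec ℚ n
u ∘ᵥ v = tabulate λ i → lookup u i * lookup v i

supp : ∀ {n} → Vec ℚ n → Subset n
supp v = tabulate λ i → if does (lookup v i ≟ 0ℚ) then outside else inside

H : ∀ {n} → Family n → Vec ℚ n → Subset n
H 𝒮 v = tabulate λ i →
  does (any? (λ s → ≡-dec _≟ᵇ_ (supp (toVec s ∘ᵥ v)) ⁅ i ⁆) 𝒮)

{-# OPTIONS --safe #-}
-- Test a shattered set A with its own indicator vector v = A: then
-- supp(S ∘ v) = A ∩ S, and since A is shattered, every {i} with i ∈ A is such a
-- trace, so A ⊆ H(𝒮, A).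
module Submission where

open import Defs
open import Data.Nat using (ℕ; _≤_)
open import Data.Fin.Subset using (Subset; ∣_∣)
open import Data.Vec using (Vec)
open import Data.Rational using (ℚ)
open import Data.Product using (∃)

open import Data.Bool using (Bool; true; false; _∧_; if_then_else_)
open import Data.Bool.Properties using () renaming (_≟_ to _≟ᵇ_)
open import Data.Fin using (Fin)
open import Data.Fin.Subset using (_∈_; _⊆_; _∩_; ⁅_⁆; inside; outside)
open import Data.Fin.Subset.Properties using (p⊆q⇒∣p∣≤∣q∣; x∈⁅y⁆⇒x≡y)
open import Data.List.Membership.Propositional using (lose) renaming (_∈_ to _∈ₗ_)
open import Data.List.Relation.Unary.Any using (any?)
open import Data.Product using (_,_)
open import Data.Rational using (0ℚ; 1ℚ; _*_)
open import Data.Rational.Properties using (_≟_)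
open import Data.Vec using ([]; _∷_; lookup)
open import Data.Vec.Properties using (lookup⇒[]=; lookup∘tabulate; ≡-dec)
open import Relation.Binary.PropositionalEquality using (_≡_; refl; sym; trans; cong₂; subst)
open import Relation.Nullary.Decidable using (does; dec-true)

bit : Bool → ℚ
bit b = if b then 1ℚ else 0ℚ

supp-bit*bit : (a b : Bool) →
  (if does (bit a * bit b ≟ 0ℚ) then outside else inside) ≡ b ∧ a
supp-bit*bit true  true  = refl
supp-bit*bit true  false = refl
supp-bit*bit false true  = refl
supp-bit*bit false false = refl

supp-toVec-∘ᵥ : ∀ {n} (s t : Subset n) → supp (toVec s ∘ᵥ toVec t) ≡ t ∩ s
supp-toVec-∘ᵥ []      []      = refl
supp-toVec-∘ᵥ (a ∷ s) (b ∷ t) = cong₂ _∷_ (supp-bit*bit a b) (supp-toVec-∘ᵥ s t)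

∈-H : ∀ {n} {𝒮 : Family n} {v : Vec ℚ n} {S : Subset n} (i : Fin n) →
  S ∈ₗ 𝒮 → supp (toVec S ∘ᵥ v) ≡ ⁅ i ⁆ → i ∈ H 𝒮 v
∈-H {𝒮 = 𝒮} {v} i S∈𝒮 supp≡⁅i⁆ = lookup⇒[]= i _ (trans (lookup∘tabulate _ i)
  (dec-true (any? (λ s → ≡-dec _≟ᵇ_ (supp (toVec s ∘ᵥ v)) ⁅ i ⁆) 𝒮)
            (lose S∈𝒮 supp≡⁅i⁆)))

x∈p⇒⁅x⁆⊆p : ∀ {n} {x : Fin n} {p : Subset n} → x ∈ p → ⁅ x ⁆ ⊆ p
x∈p⇒⁅x⁆⊆p x∈p y∈⁅x⁆ = subst (_∈ _) (sym (x∈⁅y⁆⇒x≡y _ y∈⁅x⁆)) x∈p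

Shatters⇒⊆H : ∀ {n} {𝒮 : Family n} {A : Subset n} → Shatters 𝒮 A → A ⊆ H 𝒮 (toVec A)
Shatters⇒⊆H {A = A} shatters {i} i∈A with shatters ⁅ i ⁆ (x∈p⇒⁅x⁆⊆p i∈A)
... | S , S∈𝒮 , A∩S≡⁅i⁆ = ∈-H {v = toVec A} i S∈𝒮 (trans (supp-toVec-∘ᵥ S A) A∩S≡⁅i⁆)

mainTheorem14 : (n : ℕ) (𝒮 : Family n) (A : Subset n) →
    Shatters 𝒮 A → ∃ λ (v : Vec ℚ n) → ∣ A ∣ ≤ ∣ H 𝒮 v ∣
mainTheorem14 n 𝒮 A shatters = toVec A , p⊆q⇒∣p∣≤∣q∣ (Shatters⇒⊆H shatters)
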